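{- Let $s > k \ge \ell \ge 0$ and $m \ge 0$ be integers. Suppose $A_1,\dots,A_m,B_1,\dots,B_m$ are finite sets such that $|A_i| + |B_i| = s$ and $|A_i \cap B_i| \le \ell$ for all $i \in [m]$, and $|A_i \cap B_j| + |A_j \cap B_i| \ge 2(k+1)$ for all $1 \le i < j \le m$. Then $$m \le f'\big(s-2(k+1),\, 2(k+1)-2\ell;\, \{0,1\}\big) \le \frac{2^{s-2\ell-1}}{\sum_{i=0}^{k-\ell} \binom{s-2\ell-1}{i}}.$$
   Context: For $p,q \in \{0,1\}^n$, $\mathrm{dist}(p,q)$ is the Hamming distance (number of coordinates in which they differ). For an integer $t$ and an integer $r \ge 1$, $f'(t,r;\{0,1\})$ is the maximum $m$ such that there exist an integer $n > t$ and $a_1,\dots,a_m,b_1,\dots,b_m \in \{0,1\}^n$ with $\mathrm{dist}(a_i,b_i) \ge t+r$ for all $i \in [m]$ and $\mathrm{dist}(a_i,b_j)+\mathrm{dist}(a_j,b_i) \le 2t$ for all distinct $i,j \in [m]$. -}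

module Defs where

open import Data.Bool using (Bool; true; false)
open import Data.Nat as ℕ using (ℕ; zero; suc)
open import Data.Nat.Combinatorics using (_C_)
open import Data.Integer as ℤ using (ℤ; +_)
open import Data.Fin using (Fin)
open import Data.Vec using (Vec; []; _∷_)
open import Data.Product using (Σ; _×_)
open import Relation.Binary.PropositionalEquality using (_≢_)

dist : ∀ {n} → Vec Bool n → Vec Bool n → ℕ
dist [] [] = 0
dist (true ∷ p) (true ∷ q) = dist p q
dist (false ∷ p) (false ∷ q) = dist p q
dist (true ∷ p) (false ∷ q) = suc (dist p q)
dist (false ∷ p) (true ∷ q) = suc (dist p q)

-- Admissible t r m : there exist an integer n > t and a_1..a_m, b_1..b_m in {0,1}^n
-- with dist(a_i,b_i) ≥ t + r and dist(a_i,b_j) + dist(a_j,b_i) ≤ 2t for distinct i,j.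
-- f'(t,r;{0,1}) is the maximum m with Admissible t r m.
Admissible : ℤ → ℕ → ℕ → Set
Admissible t r m =
  Σ ℕ λ n → (t ℤ.< + n) ×
  (Σ (Fin m → Vec Bool n) λ a → Σ (Fin m → Vec Bool n) λ b →
     ((i : Fin m) → t ℤ.+ + r ℤ.≤ + dist (a i) (b i)) ×
     ((i j : Fin m) → i ≢ j → + (dist (a i) (b j) ℕ.+ dist (a j) (b i)) ℤ.≤ + 2 ℤ.* t))

binomSum : ℕ → ℕ → ℕ
binomSum N zero = N C 0
binomSum N (suc K) = binomSum N K ℕ.+ N C suc K

-- Write the families as 0/1 vectors: dist p q = |p| + |q| - 2|p ∩ q| turns the hypotheses on the
-- sets into the distance conditions defining f′ (after padding the vectors so that n > t).
--
-- For the bound f′(t, 2K + 2) ≤ 2^N / Σ_{i ≤ K} (N choose i), where N = t + 2K + 1, attach to each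
-- pair (a, b) the region of points x of the cube with dist x b - dist x a > t, a tie being broken
-- by the first coordinate where a and b differ. By the triangle inequality a point in the regions
-- of two pairs i ≠ j would force dist a_i b_j + dist a_j b_i > 2t, so the regions are disjoint.
-- On the D + 1 coordinates where a and b differ, dist x b - dist x a is a ±1 walk, so the region
-- covers a fraction of the cube depending only on D; unimodality of the binomial coefficients
-- makes it nondecreasing in D, hence at least its value Σ_{i ≤ K} (N choose i) / 2^N at the
-- smallest D = N. Packing m disjoint regions into the cube gives the bound.

module Submission where

open import Defs
open import Data.Nat using (ℕ; _+_; _*_; _∸_; _^_; _≤_; _<_)
open import Data.Integer using (+_; _-_)
open import Data.Fin using (Fin) renaming (_<_ to _<ᶠ_)
open import Data.Fin.Subset using (Subset; ∣_∣; _∩_)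
open import Data.Product using (Σ; _×_)
open import Relation.Binary.PropositionalEquality using (_≡_)

open import Data.Bool using (Bool; true; false; if_then_else_; not; _∨_)
open import Data.Nat using (zero; suc; z≤n; s≤s)
import Data.Nat.Properties as ℕ
open import Data.Nat.Combinatorics using (_C_; nCk+nC[k+1]≡[n+1]C[k+1]; k>n⇒nCk≡0)
open import Data.Nat.Tactic.RingSolver using () renaming (solve-∀ to ℕ-solve)
open import Data.Integer as ℤ using (ℤ; -[1+_])
import Data.Integer.Properties as ℤ
open import Data.Integer.Tactic.RingSolver using () renaming (solve-∀ to ℤ-solve)
open import Data.Fin using () renaming (zero to fzero; suc to fsuc)
import Data.Fin.Properties as Fin
open import Data.Vec using (Vec; []; _∷_; _++_; replicate)
open import Data.Product using (_,_; proj₁; proj₂)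
open import Data.Sum using (_⊎_; inj₁; inj₂)
import Data.Sum as Sum
open import Data.Empty using (⊥; ⊥-elim)
open import Function.Bundles using (mk⇔)
open import Relation.Nullary using (does; yes; no)
open import Relation.Nullary.Decidable using (dec-true; dec-false; does-⇔)
open import Relation.Binary using (tri<; tri≈; tri>)
open import Relation.Binary.PropositionalEquality
  using (_≢_; refl; sym; trans; cong; cong₂; subst; subst₂; module ≡-Reasoning)

-- Stated with ℤ.suc and ℤ.pred unfolded, so that the ring solver can prove them.
+-sucʳ : ∀ i j → i ℤ.+ (+ 1 ℤ.+ j) ≡ + 1 ℤ.+ (i ℤ.+ j)
+-sucʳ = ℤ-solve

pred+suc : ∀ i j → (ℤ.- + 1 ℤ.+ i) ℤ.+ (+ 1 ℤ.+ j) ≡ i ℤ.+ j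
pred+suc = ℤ-solve

suc+pred : ∀ i j → (+ 1 ℤ.+ i) ℤ.+ (ℤ.- + 1 ℤ.+ j) ≡ i ℤ.+ j
suc+pred = ℤ-solve

-- ±1 walks and partial binomial sums

-- walks≥ N u is the number of ±1 sequences of length N with sum at least u.
walks≥ : ℕ → ℤ → ℕ
walks≥ zero    u = if does (u ℤ.≤? + 0) then 1 else 0
walks≥ (suc N) u = walks≥ N (ℤ.pred u) + walks≥ N (ℤ.suc u)

2^-double : ∀ N → 2 ^ N + 2 ^ N ≡ 2 ^ suc N
2^-double N = cong (_+_ (2 ^ N)) (sym (ℕ.+-identityʳ (2 ^ N)))

walks≥-complement : ∀ N u v → u ℤ.+ v ≡ + 1 → walks≥ N u + walks≥ N v ≡ 2 ^ N
walks≥-complement zero u v u+v≡1 with u ℤ.≤? + 0 | v ℤ.≤? + 0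
... | yes u≤0 | yes v≤0 with ℤ.+≤+ () ← subst (ℤ._≤ + 0) u+v≡1 (ℤ.+-mono-≤ u≤0 v≤0)
... | yes _   | no _    = refl
... | no _    | yes _   = refl
... | no u≰0  | no v≰0  with ℤ.+≤+ (s≤s ()) ← subst (+ 2 ℤ.≤_) u+v≡1 
  (ℤ.+-mono-≤ (ℤ.i<j⇒suc[i]≤j (ℤ.≰⇒> u≰0)) (ℤ.i<j⇒suc[i]≤j (ℤ.≰⇒> v≰0)))
walks≥-complement (suc N) u v u+v≡1 = begin
  (walks≥ N (ℤ.pred u) + walks≥ N (ℤ.suc u)) + (walks≥ N (ℤ.pred v) + walks≥ N (ℤ.suc v))
    ≡⟨ swap-middle (walks≥ N (ℤ.pred u)) _ _ _ ⟩
  (walks≥ N (ℤ.pred u) + walks≥ N (ℤ.suc v)) + (walks≥ N (ℤ.suc u) + walks≥ N (ℤ.pred v))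
    ≡⟨ cong₂ _+_ (walks≥-complement N _ _ (trans (pred+suc u v) u+v≡1))
                 (walks≥-complement N _ _ (trans (suc+pred u v) u+v≡1)) ⟩
  2 ^ N + 2 ^ N
    ≡⟨ 2^-double N ⟩
  2 ^ suc N ∎
  where
  open ≡-Reasoning
  swap-middle : ∀ a b c d → (a + b) + (c + d) ≡ (a + d) + (b + c)
  swap-middle = ℕ-solve

add-crossed : ∀ a b c d x y → a + b ≤ c + d → (a + x) + (y + b) ≤ (c + y) + (x + d)
add-crossed a b c d x y ab≤cd = begin
  (a + x) + (y + b) ≡⟨ regroup a x y b ⟩
  (a + b) + (x + y) ≤⟨ ℕ.+-monoˡ-≤ (x + y) ab≤cd ⟩
  (c + d) + (x + y) ≡⟨ regroup′ c d x y ⟩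
  (c + y) + (x + d) ∎
  where
  open ℕ.≤-Reasoning
  regroup : ∀ a x y b → (a + x) + (y + b) ≡ (a + b) + (x + y)
  regroup = ℕ-solve
  regroup′ : ∀ c d x y → (c + d) + (x + y) ≡ (c + y) + (x + d)
  regroup′ = ℕ-solve

telescope : ∀ a b c d e f → a + b ≤ c + d → d + e ≤ b + f → a + e ≤ c + f
telescope a b c d e f ab≤cd de≤bf = ℕ.+-cancelʳ-≤ (b + d) (a + e) (c + f) (begin
  (a + e) + (b + d) ≡⟨ regroup a e b d ⟩
  (a + b) + (d + e) ≤⟨ ℕ.+-mono-≤ ab≤cd de≤bf ⟩
  (c + d) + (b + f) ≡⟨ regroup′ c d b f ⟩
  (c + f) + (b + d) ∎)
  where
  open ℕ.≤-Reasoning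
  regroup : ∀ a e b d → (a + e) + (b + d) ≡ (a + b) + (d + e)
  regroup = ℕ-solve
  regroup′ : ∀ c d b f → (c + d) + (b + f) ≡ (c + f) + (b + d)
  regroup′ = ℕ-solve

-- Equivalently #(sum = n + 1) ≤ #(sum = n - 1): binomial coefficients decrease away from the centre.
walks≥-unimodal : ∀ N n →
  walks≥ N (+ n) + walks≥ N (+ suc n) ≤ walks≥ N (ℤ.pred (+ n)) + walks≥ N (+ suc (suc n))
walks≥-unimodal zero zero    = ℕ.≤-refl
walks≥-unimodal zero (suc n) = z≤n
walks≥-unimodal (suc N) zero =
  add-crossed (W -[1+ 0 ]) (W (+ 2)) (W -[1+ 1 ]) (W (+ 3)) (W (+ 1)) (W (+ 0))
    (ℕ.≤-reflexive (trans (walks≥-complement N _ _ refl) (sym (walks≥-complement N _ _ refl))))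
  where
  W = walks≥ N
walks≥-unimodal (suc N) (suc n) =
  add-crossed (W n) (W (3 + n)) (W′ (ℤ.pred (+ n))) (W (4 + n)) (W (2 + n)) (W (1 + n))
    (telescope (W n) (W (1 + n)) (W′ (ℤ.pred (+ n))) (W (2 + n)) (W (3 + n)) (W (4 + n))
      (walks≥-unimodal N n) (walks≥-unimodal N (2 + n)))
  where
  W′ = walks≥ N
  W = λ k → walks≥ N (+ k)

walks≥-beyond : ∀ N u → + suc N ℤ.≤ u → walks≥ N u ≡ 0
walks≥-beyond zero    u 1≤u =
  cong (λ b → if b then 1 else 0) (dec-false (u ℤ.≤? + 0) (ℤ.<⇒≱ (ℤ.suc[i]≤j⇒i<j 1≤u)))
walks≥-beyond (suc N) u 2+N≤u = cong₂ _+_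
  (walks≥-beyond N (ℤ.pred u) (ℤ.pred-mono 2+N≤u))
  (walks≥-beyond N (ℤ.suc u) (ℤ.≤-trans (ℤ.i≤j⇒pred[i]≤j 2+N≤u) (ℤ.i≤suc[i] u)))

binomSum-zero : ∀ K → binomSum 0 K ≡ 1
binomSum-zero zero    = refl
binomSum-zero (suc K) = cong₂ _+_ (binomSum-zero K) (k>n⇒nCk≡0 {0} {suc K} (s≤s z≤n))

binomSum-pascal : ∀ N K → binomSum (suc N) (suc K) ≡ binomSum N (suc K) + binomSum N K
binomSum-pascal N zero = cong suc (trans (sym (nCk+nC[k+1]≡[n+1]C[k+1] N 0)) (ℕ.+-comm 1 (N C 1)))
binomSum-pascal N (suc K) = begin
  binomSum (suc N) (suc K) + suc N C suc (suc K)
    ≡⟨ cong₂ _+_ (binomSum-pascal N K) (sym (nCk+nC[k+1]≡[n+1]C[k+1] N (suc K))) ⟩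
  (binomSum N (suc K) + binomSum N K) + (N C suc K + N C suc (suc K))
    ≡⟨ regroup (binomSum N (suc K)) (binomSum N K) (N C suc K) (N C suc (suc K)) ⟩
  (binomSum N (suc K) + N C suc (suc K)) + (binomSum N K + N C suc K) ∎
  where
  open ≡-Reasoning
  regroup : ∀ a b c d → (a + b) + (c + d) ≡ (a + d) + (b + c)
  regroup = ℕ-solve

-- A walk ends at ≥ u exactly when at most K of its steps are -1, where K = ⌊(N - u) / 2⌋.
walks≥-binomSum : ∀ N K b u → b ≤ 1 → u ℤ.+ + (b + 2 * K) ≡ + N → walks≥ N u ≡ binomSum N K
walks≥-binomSum zero K b u _ u+c≡0 = trans
  (cong (λ b → if b then 1 else 0) (dec-true (u ℤ.≤? + 0) (subst (u ℤ.≤_) u+c≡0 (ℤ.i≤i+j u _))))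
  (sym (binomSum-zero K))
walks≥-binomSum (suc N) zero b u b≤1 u+b≡1+N = cong₂ _+_
  (walks≥-binomSum N zero b (ℤ.pred u) b≤1 (trans (ℤ.pred-+ u _) (cong ℤ.pred u+b≡1+N)))
  (walks≥-beyond N (ℤ.suc u) (begin
    + suc N             ≡⟨ sym u+b≡1+N ⟩
    u ℤ.+ + (b + 2 * 0) ≤⟨ ℤ.+-monoʳ-≤ u (ℤ.+≤+ (subst (_≤ 1) (sym (ℕ.+-identityʳ b)) b≤1)) ⟩
    u ℤ.+ + 1           ≡⟨ ℤ.+-comm u (+ 1) ⟩
    ℤ.suc u             ∎))
  where open ℤ.≤-Reasoning
walks≥-binomSum (suc N) (suc K) b u b≤1 u+c≡1+N = trans
  (cong₂ _+_
    (walks≥-binomSum N (suc K) b (ℤ.pred u) b≤1 (trans (ℤ.pred-+ u _) (cong ℤ.pred u+c≡1+N)))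
    (walks≥-binomSum N K b (ℤ.suc u) b≤1 (begin
      ℤ.suc u ℤ.+ + (b + 2 * K)           ≡⟨ shift u (+ (b + 2 * K)) ⟩
      ℤ.pred (u ℤ.+ + (2 + (b + 2 * K)))  ≡⟨ cong (λ c → ℤ.pred (u ℤ.+ + c)) (two-more b K) ⟩
      ℤ.pred (u ℤ.+ + (b + 2 * suc K))    ≡⟨ cong ℤ.pred u+c≡1+N ⟩
      + N                                  ∎)))
  (sym (binomSum-pascal N K))
  where
  open ≡-Reasoning
  shift : ∀ u c → (+ 1 ℤ.+ u) ℤ.+ c ≡ ℤ.- + 1 ℤ.+ (u ℤ.+ (+ 2 ℤ.+ c))
  shift = ℤ-solve
  two-more : ∀ b K → 2 + (b + 2 * K) ≡ b + 2 * suc K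
  two-more = ℕ-solve

binomSum≤2^ : ∀ N K → binomSum N K ≤ 2 ^ N
binomSum≤2^ N K = begin
  binomSum N K                    ≡⟨ sym (walks≥-binomSum N K 0 u z≤n (cancel (+ N) (+ (2 * K)))) ⟩
  walks≥ N u                      ≤⟨ ℕ.m≤m+n (walks≥ N u) _ ⟩
  walks≥ N u + walks≥ N (+ 1 ℤ.- u) ≡⟨ walks≥-complement N u (+ 1 ℤ.- u) (complement u) ⟩
  2 ^ N                           ∎
  where
  open ℕ.≤-Reasoning
  u = + N ℤ.- + (2 * K)
  cancel : ∀ n c → (n ℤ.- c) ℤ.+ c ≡ n
  cancel = ℤ-solve
  complement : ∀ u → u ℤ.+ (+ 1 ℤ.- u) ≡ + 1
  complement = ℤ-solve

walks≥₂ : ℕ → ℤ → ℕ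
walks≥₂ N u = walks≥ N u + walks≥ N (ℤ.suc u)

walks≥₂-double : ∀ N n → 2 * walks≥₂ N (+ n) ≤ walks≥₂ (suc N) (+ n)
walks≥₂-double N n = begin
  2 * (W (+ n) + W (+ suc n))                       ≡⟨ twice (W (+ n) + W (+ suc n)) ⟩
  (W (+ n) + W (+ suc n)) + (W (+ n) + W (+ suc n))
    ≤⟨ ℕ.+-monoˡ-≤ _ (walks≥-unimodal N n) ⟩
  (W (ℤ.pred (+ n)) + W (+ suc (suc n))) + (W (+ n) + W (+ suc n))
    ≡⟨ regroup (W (ℤ.pred (+ n))) (W (+ suc (suc n))) (W (+ n)) (W (+ suc n)) ⟩
  (W (ℤ.pred (+ n)) + W (+ suc n)) + (W (+ n) + W (+ suc (suc n))) ∎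
  where
  open ℕ.≤-Reasoning
  W = walks≥ N
  twice : ∀ x → 2 * x ≡ x + x
  twice = ℕ-solve
  regroup : ∀ a b c d → (a + b) + (c + d) ≡ (a + d) + (c + b)
  regroup = ℕ-solve

walks≥₂-grows : ∀ j N n → 2 ^ j * walks≥₂ N (+ n) ≤ walks≥₂ (j + N) (+ n)
walks≥₂-grows zero    N n = ℕ.≤-reflexive (ℕ.*-identityˡ _)
walks≥₂-grows (suc j) N n = begin
  2 * 2 ^ j * walks≥₂ N (+ n)   ≡⟨ ℕ.*-assoc 2 (2 ^ j) _ ⟩
  2 * (2 ^ j * walks≥₂ N (+ n)) ≤⟨ ℕ.*-monoʳ-≤ 2 (walks≥₂-grows j N n) ⟩
  2 * walks≥₂ (j + N) (+ n)     ≤⟨ walks≥₂-double (j + N) n ⟩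
  walks≥₂ (suc j + N) (+ n)     ∎
  where open ℕ.≤-Reasoning

walks≥₂-centre : ∀ t K →
  walks≥₂ (t + suc (2 * K)) (+ t) ≡ binomSum (t + suc (2 * K)) K + binomSum (t + suc (2 * K)) K
walks≥₂-centre t K = cong₂ _+_
  (walks≥-binomSum _ K 1 (+ t) ℕ.≤-refl refl)
  (walks≥-binomSum _ K 0 (+ suc t) z≤n (cong +_ (sym (ℕ.+-suc t (2 * K)))))

-- Counting points of the cube

count : ∀ {n} → (Vec Bool n → Bool) → ℕ
count {zero}  P = if P [] then 1 else 0
count {suc n} P = count (λ x → P (true ∷ x)) + count (λ x → P (false ∷ x))

count-cong : ∀ {n} {P Q : Vec Bool n → Bool} → (∀ x → P x ≡ Q x) → count P ≡ count Q
count-cong {zero}  P≗Q = cong (λ b → if b then 1 else 0) (P≗Q [])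
count-cong {suc n} P≗Q =
  cong₂ _+_ (count-cong (λ x → P≗Q (true ∷ x))) (count-cong (λ x → P≗Q (false ∷ x)))

count≤2^ : ∀ {n} (P : Vec Bool n → Bool) → count P ≤ 2 ^ n
count≤2^ {zero} P with P []
... | true  = ℕ.≤-refl
... | false = z≤n
count≤2^ {suc n} P = ℕ.≤-trans
  (ℕ.+-mono-≤ (count≤2^ (λ x → P (true ∷ x))) (count≤2^ (λ x → P (false ∷ x))))
  (ℕ.≤-reflexive (2^-double n))

Disjoint : ∀ {n} → (Vec Bool n → Bool) → (Vec Bool n → Bool) → Set
Disjoint P Q = ∀ x → P x ≡ true → Q x ≡ true → ⊥

count-∨ : ∀ {n} {P Q : Vec Bool n → Bool} → Disjoint P Q →
  count (λ x → P x ∨ Q x) ≡ count P + count Q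
count-∨ {zero} {P} {Q} P∩Q=∅ with P [] in p | Q [] in q
... | true  | true  = ⊥-elim (P∩Q=∅ [] p q)
... | true  | false = refl
... | false | _     = refl
count-∨ {suc n} {P} {Q} P∩Q=∅ = trans
  (cong₂ _+_ (count-∨ (λ x → P∩Q=∅ (true ∷ x))) (count-∨ (λ x → P∩Q=∅ (false ∷ x))))
  (regroup (count (λ x → P (true ∷ x))) (count (λ x → Q (true ∷ x)))
           (count (λ x → P (false ∷ x))) (count (λ x → Q (false ∷ x))))
  where
  regroup : ∀ a b c d → (a + b) + (c + d) ≡ (a + c) + (b + d)
  regroup = ℕ-solve

anyOf : ∀ {m n} → (Fin m → Vec Bool n → Bool) → Vec Bool n → Bool
anyOf {zero}  P x = false
anyOf {suc m} P x = P fzero x ∨ anyOf (λ i → P (fsuc i)) x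

anyOf-witness : ∀ {m n} (P : Fin m → Vec Bool n → Bool) x →
  anyOf P x ≡ true → Σ (Fin m) λ i → P i x ≡ true
anyOf-witness {suc m} P x any with P fzero x in p
... | true  = fzero , p
... | false with i , q ← anyOf-witness (λ i → P (fsuc i)) x any = fsuc i , q

packing-anyOf : ∀ {m n} (P : Fin m → Vec Bool n → Bool) c L →
  (∀ {i j} → i ≢ j → Disjoint (P i) (P j)) →
  (∀ i → L ≤ c * count (P i)) → m * L ≤ c * count (anyOf P)
packing-anyOf {zero}  P c L disjoint large = z≤n
packing-anyOf {suc m} P c L disjoint large = begin
  L + m * L                                       ≤⟨ ℕ.+-mono-≤ (large fzero) rest-packed ⟩
  c * count (P fzero) + c * count (anyOf Prest)   ≡⟨ sym (ℕ.*-distribˡ-+ c _ _) ⟩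
  c * (count (P fzero) + count (anyOf Prest))     ≡⟨ cong (c *_) (sym (count-∨ first-vs-rest)) ⟩
  c * count (anyOf P)                             ∎
  where
  open ℕ.≤-Reasoning
  Prest = λ i → P (fsuc i)
  rest-packed : m * L ≤ c * count (anyOf Prest)
  rest-packed = packing-anyOf Prest c L
    (λ i≢j → disjoint (λ i≡j → i≢j (Fin.suc-injective i≡j))) (λ i → large (fsuc i))
  first-vs-rest : Disjoint (P fzero) (anyOf Prest)
  first-vs-rest x p rest with i , q ← anyOf-witness Prest x rest = disjoint (λ ()) x p q

packing : ∀ {m n} (P : Fin m → Vec Bool n → Bool) c L →
  (∀ {i j} → i ≢ j → Disjoint (P i) (P j)) →
  (∀ i → L ≤ c * count (P i)) → m * L ≤ c * 2 ^ n
packing P c L disjoint large =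
  ℕ.≤-trans (packing-anyOf P c L disjoint large) (ℕ.*-monoʳ-≤ c (count≤2^ (anyOf P)))

-- The region of the cube attached to a pair

lean : ∀ {n} → Vec Bool n → Vec Bool n → Vec Bool n → ℤ
lean []      []          []          = + 0
lean (_ ∷ x) (true ∷ a)  (true ∷ b)  = lean x a b
lean (_ ∷ x) (false ∷ a) (false ∷ b) = lean x a b
lean (y ∷ x) (true ∷ a)  (false ∷ b) = if y then ℤ.suc (lean x a b) else ℤ.pred (lean x a b)
lean (y ∷ x) (false ∷ a) (true ∷ b)  = if y then ℤ.pred (lean x a b) else ℤ.suc (lean x a b)

lean-dist : ∀ {n} (x a b : Vec Bool n) → lean x a b ℤ.+ + dist x a ≡ + dist x b
lean-dist [] [] [] = refl
lean-dist (true  ∷ x) (true  ∷ a) (true  ∷ b) = lean-dist x a b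
lean-dist (false ∷ x) (false ∷ a) (false ∷ b) = lean-dist x a b
lean-dist (false ∷ x) (true  ∷ a) (true  ∷ b) =
  trans (+-sucʳ (lean x a b) _) (cong ℤ.suc (lean-dist x a b))
lean-dist (true  ∷ x) (false ∷ a) (false ∷ b) =
  trans (+-sucʳ (lean x a b) _) (cong ℤ.suc (lean-dist x a b))
lean-dist (true  ∷ x) (true  ∷ a) (false ∷ b) =
  trans (ℤ.+-assoc (+ 1) (lean x a b) _) (cong ℤ.suc (lean-dist x a b))
lean-dist (false ∷ x) (false ∷ a) (true  ∷ b) =
  trans (ℤ.+-assoc (+ 1) (lean x a b) _) (cong ℤ.suc (lean-dist x a b))
lean-dist (false ∷ x) (true  ∷ a) (false ∷ b) = trans (pred+suc (lean x a b) _) (lean-dist x a b)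
lean-dist (true  ∷ x) (false ∷ a) (true  ∷ b) = trans (pred+suc (lean x a b) _) (lean-dist x a b)

agreements : ∀ {n} → Vec Bool n → Vec Bool n → ℕ
agreements []          []          = 0
agreements (true ∷ a)  (true ∷ b)  = suc (agreements a b)
agreements (false ∷ a) (false ∷ b) = suc (agreements a b)
agreements (true ∷ a)  (false ∷ b) = agreements a b
agreements (false ∷ a) (true ∷ b)  = agreements a b

agreements+dist : ∀ {n} (a b : Vec Bool n) → agreements a b + dist a b ≡ n
agreements+dist []          []          = refl
agreements+dist (true ∷ a)  (true ∷ b)  = cong suc (agreements+dist a b)
agreements+dist (false ∷ a) (false ∷ b) = cong suc (agreements+dist a b)
agreements+dist (true ∷ a)  (false ∷ b) = trans (ℕ.+-suc _ _) (cong suc (agreements+dist a b))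
agreements+dist (false ∷ a) (true ∷ b)  = trans (ℕ.+-suc _ _) (cong suc (agreements+dist a b))

off : Bool → Bool → Bool → ℕ
off true  false true  = 1
off false true  false = 1
off _     _     _     = 0

detour : ∀ {n} → Vec Bool n → Vec Bool n → Vec Bool n → ℕ
detour []      []      []      = 0
detour (y ∷ x) (c ∷ a) (d ∷ b) = off y c d + detour x a b

detour-step : ∀ {p q r d} → p + q ≡ r + 2 * d → suc p + suc q ≡ r + 2 * suc d
detour-step {p} {q} {r} {d} eq = begin
  suc p + suc q         ≡⟨ cong suc (ℕ.+-suc p q) ⟩
  suc (suc (p + q))     ≡⟨ cong (λ z → suc (suc z)) eq ⟩
  suc (suc (r + 2 * d)) ≡⟨ two-more r d ⟩
  r + 2 * suc d         ∎
  where
  open ≡-Reasoning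
  two-more : ∀ r d → suc (suc (r + 2 * d)) ≡ r + 2 * suc d
  two-more = ℕ-solve

dist-detour : ∀ {n} (x a b : Vec Bool n) → dist x a + dist a b ≡ dist x b + 2 * detour x a b
dist-detour [] [] [] = refl
dist-detour (true  ∷ x) (true  ∷ a) (true  ∷ b) = dist-detour x a b
dist-detour (false ∷ x) (false ∷ a) (false ∷ b) = dist-detour x a b
dist-detour (true  ∷ x) (false ∷ a) (false ∷ b) = cong suc (dist-detour x a b)
dist-detour (false ∷ x) (true  ∷ a) (true  ∷ b) = cong suc (dist-detour x a b)
dist-detour (true  ∷ x) (true  ∷ a) (false ∷ b) = trans (ℕ.+-suc _ _) (cong suc (dist-detour x a b))
dist-detour (false ∷ x) (false ∷ a) (true  ∷ b) = trans (ℕ.+-suc _ _) (cong suc (dist-detour x a b))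
dist-detour (true  ∷ x) (false ∷ a) (true  ∷ b) = detour-step (dist-detour x a b)
dist-detour (false ∷ x) (true  ∷ a) (false ∷ b) = detour-step (dist-detour x a b)

tieBreak : ∀ {n} → Vec Bool n → Vec Bool n → Vec Bool n → Bool
tieBreak []      []          []          = false
tieBreak (_ ∷ x) (true ∷ a)  (true ∷ b)  = tieBreak x a b
tieBreak (_ ∷ x) (false ∷ a) (false ∷ b) = tieBreak x a b
tieBreak (y ∷ _) (true ∷ _)  (false ∷ _) = not y
tieBreak (y ∷ _) (false ∷ _) (true ∷ _)  = y

tieBreak-head : ∀ {n} y c d (x a b : Vec Bool n) → tieBreak (y ∷ x) (c ∷ a) (d ∷ b) ≡ true →
  (c ≡ d × tieBreak x a b ≡ true) ⊎ (c ≢ d × y ≡ d)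
tieBreak-head _     true  true  x a b tb = inj₁ (refl , tb)
tieBreak-head _     false false x a b tb = inj₁ (refl , tb)
tieBreak-head false true  false x a b tb = inj₂ ((λ ()) , refl)
tieBreak-head true  false true  x a b tb = inj₂ ((λ ()) , refl)
tieBreak-head true  true  false x a b ()
tieBreak-head false false true  x a b ()

off-positive : ∀ y c c′ d′ → c ≢ y → c′ ≡ d′ ⊎ y ≡ d′ → 1 ≤ off y c′ y + off y c d′
off-positive true  true  _     _     c≢y _          = ⊥-elim (c≢y refl)
off-positive false false _     _     c≢y _          = ⊥-elim (c≢y refl)
off-positive true  false false _     _   _          = s≤s z≤n
off-positive true  false true  true  _   _          = s≤s z≤n
off-positive true  false true  false _   (inj₁ ())
off-positive true  false true  false _   (inj₂ ())
off-positive false true  true  _     _   _          = s≤s z≤n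
off-positive false true  false false _   _          = s≤s z≤n
off-positive false true  false true  _   (inj₁ ())
off-positive false true  false true  _   (inj₂ ())

-- At the first coordinate where one of the pairs splits, x sides with that pair's b,
-- which forces a detour through the other pair's a.
tieBreak-detour : ∀ {n} (x ai bi aj bj : Vec Bool n) →
  tieBreak x ai bi ≡ true → tieBreak x aj bj ≡ true → 1 ≤ detour x aj bi + detour x ai bj
tieBreak-detour [] [] [] [] [] () _
tieBreak-detour (y ∷ x) (ci ∷ ai) (di ∷ bi) (cj ∷ aj) (dj ∷ bj) tbi tbj
  with tieBreak-head y ci di x ai bi tbi | tieBreak-head y cj dj x aj bj tbj
... | inj₁ (refl , tbi′) | inj₁ (refl , tbj′) =
  ℕ.≤-trans (tieBreak-detour x ai bi aj bj tbi′ tbj′)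
            (ℕ.+-mono-≤ (ℕ.m≤n+m _ (off y cj ci)) (ℕ.m≤n+m _ (off y ci cj)))
... | inj₂ (ci≢di , refl) | headj =
  ℕ.≤-trans (off-positive y ci cj dj ci≢di (Sum.map proj₁ proj₂ headj))
            (ℕ.+-mono-≤ (ℕ.m≤m+n (off y cj y) (detour x aj bi))
                        (ℕ.m≤m+n (off y ci dj) (detour x ai bj)))
... | inj₁ (refl , _) | inj₂ (cj≢dj , refl) =
  ℕ.≤-trans (off-positive y cj ci ci cj≢dj (inj₁ refl))
            (ℕ.≤-trans (ℕ.≤-reflexive (ℕ.+-comm (off y ci y) (off y cj ci)))
                       (ℕ.+-mono-≤ (ℕ.m≤m+n (off y cj ci) (detour x aj bi))
                                   (ℕ.m≤m+n (off y ci y) (detour x ai bj))))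

≤-suc⇔ : ∀ w l → does (w ℤ.≤? ℤ.suc l) ≡ does (ℤ.pred w ℤ.≤? l)
≤-suc⇔ w l = does-⇔ (mk⇔
  (λ w≤1+l → subst (ℤ.pred w ℤ.≤_) (ℤ.pred-suc l) (ℤ.pred-mono w≤1+l))
  (λ w-1≤l → subst (ℤ._≤ ℤ.suc l) (ℤ.suc-pred w) (ℤ.suc-mono w-1≤l)))
  (w ℤ.≤? ℤ.suc l) (ℤ.pred w ℤ.≤? l)

≤-pred⇔ : ∀ w l → does (w ℤ.≤? ℤ.pred l) ≡ does (ℤ.suc w ℤ.≤? l)
≤-pred⇔ w l = does-⇔ (mk⇔
  (λ w≤l-1 → subst (ℤ.suc w ℤ.≤_) (ℤ.suc-pred l) (ℤ.suc-mono w≤l-1))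
  (λ 1+w≤l → subst (ℤ._≤ ℤ.pred l) (ℤ.pred-suc w) (ℤ.pred-mono 1+w≤l)))
  (w ℤ.≤? ℤ.pred l) (ℤ.suc w ℤ.≤? l)

count-double : ∀ {c} e W → c ≡ 2 ^ e * W → c + c ≡ 2 ^ suc e * W
count-double e W refl =
  trans (cong (_+_ (2 ^ e * W)) (sym (ℕ.+-identityʳ _))) (sym (ℕ.*-assoc 2 (2 ^ e) W))

-- On coordinates where a and b agree the lean does not depend on x; on the others it is a ±1 walk.
count-lean≥ : ∀ {n} (a b : Vec Bool n) w →
  count (λ x → does (w ℤ.≤? lean x a b)) ≡ 2 ^ agreements a b * walks≥ (dist a b) w
count-lean≥ []          []          w = sym (ℕ.*-identityˡ _)
count-lean≥ (true ∷ a)  (true ∷ b)  w = count-double (agreements a b) _ (count-lean≥ a b w)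
count-lean≥ (false ∷ a) (false ∷ b) w = count-double (agreements a b) _ (count-lean≥ a b w)
count-lean≥ (true ∷ a)  (false ∷ b) w = trans
  (cong₂ _+_ (trans (count-cong λ x → ≤-suc⇔ w (lean x a b)) (count-lean≥ a b (ℤ.pred w)))
             (trans (count-cong λ x → ≤-pred⇔ w (lean x a b)) (count-lean≥ a b (ℤ.suc w))))
  (sym (ℕ.*-distribˡ-+ (2 ^ agreements a b) _ _))
count-lean≥ (false ∷ a) (true ∷ b)  w = trans
  (cong₂ _+_ (trans (count-cong λ x → ≤-pred⇔ w (lean x a b)) (count-lean≥ a b (ℤ.suc w)))
             (trans (count-cong λ x → ≤-suc⇔ w (lean x a b)) (count-lean≥ a b (ℤ.pred w))))
  (trans (ℕ.+-comm (2 ^ agreements a b * walks≥ (dist a b) (ℤ.suc w)) _)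
         (sym (ℕ.*-distribˡ-+ (2 ^ agreements a b) _ _)))

-- dist x b - dist x a > t, where a tie (= t) counts only when it is broken towards b.
nearer : ∀ {n} → ℕ → Vec Bool n → Vec Bool n → Vec Bool n → Bool
nearer t a b x = does (+ (if tieBreak x a b then t else suc t) ℤ.≤? lean x a b)

count-nearer : ∀ {n} t (a b : Vec Bool n) D → dist a b ≡ suc D →
  count (nearer t a b) ≡ 2 ^ agreements a b * walks≥₂ D (+ t)
count-nearer t []          []          D ()
count-nearer t (true ∷ a)  (true ∷ b)  D d≡1+D =
  count-double (agreements a b) _ (count-nearer t a b D d≡1+D)
count-nearer t (false ∷ a) (false ∷ b) D d≡1+D =
  count-double (agreements a b) _ (count-nearer t a b D d≡1+D)
count-nearer t (true ∷ a)  (false ∷ b) D refl = trans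
  (cong₂ _+_ (trans (count-cong λ x → ≤-suc⇔ (+ suc t) (lean x a b)) (count-lean≥ a b (+ t)))
             (trans (count-cong λ x → ≤-pred⇔ (+ t) (lean x a b)) (count-lean≥ a b (+ suc t))))
  (sym (ℕ.*-distribˡ-+ (2 ^ agreements a b) _ _))
count-nearer t (false ∷ a) (true ∷ b)  D refl = trans
  (cong₂ _+_ (trans (count-cong λ x → ≤-pred⇔ (+ t) (lean x a b)) (count-lean≥ a b (+ suc t)))
             (trans (count-cong λ x → ≤-suc⇔ (+ suc t) (lean x a b)) (count-lean≥ a b (+ t))))
  (trans (ℕ.+-comm (2 ^ agreements a b * walks≥ D (+ suc t)) _)
         (sym (ℕ.*-distribˡ-+ (2 ^ agreements a b) _ _)))

nearer⇒ : ∀ {n} t (a b x : Vec Bool n) → nearer t a b x ≡ true →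
  (if tieBreak x a b then t else suc t) + dist x a ≤ dist x b
nearer⇒ t a b x near with + (if tieBreak x a b then t else suc t) ℤ.≤? lean x a b | near
... | yes θ≤lean | _ = ℤ.drop‿+≤+ (begin
  + (if tieBreak x a b then t else suc t) ℤ.+ + dist x a ≤⟨ ℤ.+-monoˡ-≤ (+ dist x a) θ≤lean ⟩
  lean x a b ℤ.+ + dist x a                              ≡⟨ lean-dist x a b ⟩
  + dist x b                                             ∎)
  where open ℤ.≤-Reasoning
... | no _ | ()

tie-slack : ∀ {n} t (x ai bi aj bj : Vec Bool n) →
  suc (t + t) ≤ ((if tieBreak x ai bi then t else suc t) + (if tieBreak x aj bj then t else suc t))
                + 2 * (detour x aj bi + detour x ai bj)
tie-slack t x ai bi aj bj with tieBreak x ai bi in tbi | tieBreak x aj bj in tbj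
... | false | false = ℕ.m≤n⇒m≤n+o _ (s≤s (ℕ.+-monoʳ-≤ t (ℕ.n≤1+n t)))
... | false | true  = ℕ.m≤m+n (suc (t + t)) _
... | true  | false = ℕ.m≤n⇒m≤n+o _ (ℕ.≤-reflexive (sym (ℕ.+-suc t t)))
... | true  | true  = ℕ.≤-trans (ℕ.≤-reflexive (ℕ.+-comm 1 (t + t)))
  (ℕ.+-monoʳ-≤ (t + t) (ℕ.≤-trans (tieBreak-detour x ai bi aj bj tbi tbj) (ℕ.m≤n*m _ 2)))

nearer-disjoint : ∀ {n} t (ai bi aj bj : Vec Bool n) → dist ai bj + dist aj bi ≤ 2 * t →
  Disjoint (nearer t ai bi) (nearer t aj bj)
nearer-disjoint t ai bi aj bj close x near-i near-j = ℕ.n≮n ((t + t) + X) (begin-strict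
  (t + t) + X                                   <⟨ ℕ.+-monoˡ-≤ X (tie-slack t x ai bi aj bj) ⟩
  ((θi + θj) + 2 * (δi + δj)) + X               ≡⟨ regroup₁ θi θj δi δj (dist x ai) (dist x aj) ⟩
  ((θi + dist x ai) + (θj + dist x aj)) + 2 * (δi + δj)
    ≤⟨ ℕ.+-monoˡ-≤ _ (ℕ.+-mono-≤ (nearer⇒ t ai bi x near-i) (nearer⇒ t aj bj x near-j)) ⟩
  (dist x bi + dist x bj) + 2 * (δi + δj)       ≡⟨ regroup₂ (dist x bi) (dist x bj) δi δj ⟩
  (dist x bi + 2 * δi) + (dist x bj + 2 * δj)   ≡⟨ sym (cong₂ _+_ (dist-detour x aj bi) (dist-detour x ai bj)) ⟩
  (dist x aj + dist aj bi) + (dist x ai + dist ai bj)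
    ≡⟨ regroup₃ (dist x ai) (dist x aj) (dist ai bj) (dist aj bi) ⟩
  X + (dist ai bj + dist aj bi)                 ≤⟨ ℕ.+-monoʳ-≤ X close ⟩
  X + 2 * t                                     ≡⟨ regroup₄ X t ⟩
  (t + t) + X                                   ∎)
  where
  open ℕ.≤-Reasoning
  X  = dist x ai + dist x aj
  θi = if tieBreak x ai bi then t else suc t
  θj = if tieBreak x aj bj then t else suc t
  δi = detour x aj bi
  δj = detour x ai bj
  regroup₁ : ∀ p q r s u v → ((p + q) + 2 * (r + s)) + (u + v) ≡ ((p + u) + (q + v)) + 2 * (r + s)
  regroup₁ = ℕ-solve
  regroup₂ : ∀ p q r s → (p + q) + 2 * (r + s) ≡ (p + 2 * r) + (q + 2 * s)
  regroup₂ = ℕ-solve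
  regroup₃ : ∀ p q r s → (q + s) + (p + r) ≡ (p + q) + (r + s)
  regroup₃ = ℕ-solve
  regroup₄ : ∀ p q → p + 2 * q ≡ (q + q) + p
  regroup₄ = ℕ-solve

count-nearer-bound : ∀ {n} t K (a b : Vec Bool n) → t + suc (2 * K) < dist a b →
  2 ^ n * binomSum (t + suc (2 * K)) K ≤ 2 ^ (t + suc (2 * K)) * count (nearer t a b)
count-nearer-bound {n} t K a b N<d with o , N+1+o≡d ← ℕ.m≤n⇒∃[o]m+o≡n N<d = begin
  2 ^ n * V                                   ≡⟨ cong (λ k → 2 ^ k * V) dimension ⟩
  2 ^ (e + suc (o + N)) * V                   ≡⟨ powers e o ⟩
  2 ^ N * (2 ^ e * (2 ^ o * (V + V)))
    ≡⟨ cong (λ w → 2 ^ N * (2 ^ e * (2 ^ o * w))) (sym (walks≥₂-centre t K)) ⟩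
  2 ^ N * (2 ^ e * (2 ^ o * walks≥₂ N (+ t)))
    ≤⟨ ℕ.*-monoʳ-≤ (2 ^ N) (ℕ.*-monoʳ-≤ (2 ^ e) (walks≥₂-grows o N t)) ⟩
  2 ^ N * (2 ^ e * walks≥₂ (o + N) (+ t))
    ≡⟨ cong (2 ^ N *_) (sym (count-nearer t a b (o + N) d≡1+o+N)) ⟩
  2 ^ N * count (nearer t a b)                ∎
  where
  open ℕ.≤-Reasoning
  N = t + suc (2 * K)
  V = binomSum N K
  e = agreements a b
  d≡1+o+N : dist a b ≡ suc (o + N)
  d≡1+o+N = trans (sym N+1+o≡d) (cong suc (ℕ.+-comm N o))
  dimension : n ≡ e + suc (o + N)
  dimension = trans (sym (agreements+dist a b)) (cong (_+_ e) d≡1+o+N)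
  powers : ∀ e o → 2 ^ (e + suc (o + N)) * V ≡ 2 ^ N * (2 ^ e * (2 ^ o * (V + V)))
  powers e o = begin-equality
    2 ^ (e + suc (o + N)) * V             ≡⟨ cong (_* V) (ℕ.^-distribˡ-+-* 2 e (suc (o + N))) ⟩
    2 ^ e * (2 * 2 ^ (o + N)) * V         ≡⟨ cong (λ p → 2 ^ e * (2 * p) * V) (ℕ.^-distribˡ-+-* 2 o N) ⟩
    2 ^ e * (2 * (2 ^ o * 2 ^ N)) * V     ≡⟨ regroup (2 ^ e) (2 ^ o) (2 ^ N) V ⟩
    2 ^ N * (2 ^ e * (2 ^ o * (V + V)))   ∎
    where
    regroup : ∀ p q r v → p * (2 * (q * r)) * v ≡ r * (p * (q * (v + v)))
    regroup = ℕ-solve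

cube-packing : ∀ {m n} t K (a b : Fin m → Vec Bool n) →
  (∀ i → t + 2 * suc K ≤ dist (a i) (b i)) →
  (∀ {i j} → i ≢ j → dist (a i) (b j) + dist (a j) (b i) ≤ 2 * t) →
  m * binomSum (t + suc (2 * K)) K ≤ 2 ^ (t + suc (2 * K))
cube-packing {m} {n} t K a b far close = ℕ.*-cancelʳ-≤ (m * V) (2 ^ N) (2 ^ n) {{ℕ.m^n≢0 2 n}} (begin
  m * V * 2 ^ n   ≡⟨ ℕ.*-assoc m V (2 ^ n) ⟩
  m * (V * 2 ^ n) ≡⟨ cong (m *_) (ℕ.*-comm V (2 ^ n)) ⟩
  m * (2 ^ n * V) ≤⟨ packing (λ i → nearer t (a i) (b i)) (2 ^ N) (2 ^ n * V)
                       (λ {i} {j} i≢j → nearer-disjoint t (a i) (b i) (a j) (b j) (close i≢j))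
                       (λ i → count-nearer-bound t K (a i) (b i) (N<d i)) ⟩
  2 ^ N * 2 ^ n   ∎)
  where
  open ℕ.≤-Reasoning
  N = t + suc (2 * K)
  V = binomSum N K
  N<d : ∀ i → N < dist (a i) (b i)
  N<d i = ℕ.≤-trans (ℕ.≤-reflexive (radius t K)) (far i)
    where
    radius : ∀ t K → suc (t + suc (2 * K)) ≡ t + 2 * suc K
    radius = ℕ-solve

-- Set pairs and admissible families

admissible-bound : ∀ t K m → Admissible (+ t) (2 * suc K) m →
  m * binomSum (t + suc (2 * K)) K ≤ 2 ^ (t + suc (2 * K))
admissible-bound t K m (_ , _ , a , b , far , close) = cube-packing t K a b
  (λ i → ℤ.drop‿+≤+ (far i))
  (λ {i} {j} i≢j → ℤ.drop‿+≤+ (subst (ℤ._≤_ _) (sym (ℤ.pos-* 2 t)) (close i j i≢j)))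

admissible-nonneg : ∀ {t r m} → Admissible t r (suc (suc m)) → Σ ℕ λ t′ → t ≡ + t′
admissible-nonneg {+ t′}      _                           = t′ , refl
admissible-nonneg { -[1+ _ ]} (_ , _ , _ , _ , _ , close) with close fzero (fsuc fzero) (λ ())
... | ()

dist-∩ : ∀ {N} (p q : Subset N) → dist p q + 2 * ∣ p ∩ q ∣ ≡ ∣ p ∣ + ∣ q ∣
dist-∩ []          []          = refl
dist-∩ (true ∷ p)  (true ∷ q)  = trans (two-more (dist p q) ∣ p ∩ q ∣)
  (trans (cong (λ z → suc (suc z)) (dist-∩ p q)) (sym (ℕ.+-suc (suc ∣ p ∣) ∣ q ∣)))
  where
  two-more : ∀ d c → d + 2 * suc c ≡ suc (suc (d + 2 * c))
  two-more = ℕ-solve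
dist-∩ (true ∷ p)  (false ∷ q) = cong suc (dist-∩ p q)
dist-∩ (false ∷ p) (true ∷ q)  = trans (cong suc (dist-∩ p q)) (sym (ℕ.+-suc ∣ p ∣ ∣ q ∣))
dist-∩ (false ∷ p) (false ∷ q) = dist-∩ p q

dist-self : ∀ {n} (z : Vec Bool n) → dist z z ≡ 0
dist-self []          = refl
dist-self (true ∷ z)  = dist-self z
dist-self (false ∷ z) = dist-self z

dist-++ : ∀ {n k} (x y : Vec Bool n) (z : Vec Bool k) → dist (x ++ z) (y ++ z) ≡ dist x y
dist-++ []          []          z = dist-self z
dist-++ (true ∷ x)  (true ∷ y)  z = dist-++ x y z
dist-++ (true ∷ x)  (false ∷ y) z = cong suc (dist-++ x y z)
dist-++ (false ∷ x) (true ∷ y)  z = cong suc (dist-++ x y z)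
dist-++ (false ∷ x) (false ∷ y) z = dist-++ x y z

cross-dist-∩ : ∀ {N s} (p q p′ q′ : Subset N) → ∣ p ∣ + ∣ q ∣ ≡ s → ∣ p′ ∣ + ∣ q′ ∣ ≡ s →
  (dist p q′ + dist p′ q) + 2 * (∣ p ∩ q′ ∣ + ∣ p′ ∩ q ∣) ≡ 2 * s
cross-dist-∩ {s = s} p q p′ q′ pq≡s p′q′≡s = begin
  (dist p q′ + dist p′ q) + 2 * (∣ p ∩ q′ ∣ + ∣ p′ ∩ q ∣)
    ≡⟨ regroup (dist p q′) (dist p′ q) (∣ p ∩ q′ ∣) (∣ p′ ∩ q ∣) ⟩
  (dist p q′ + 2 * ∣ p ∩ q′ ∣) + (dist p′ q + 2 * ∣ p′ ∩ q ∣)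
    ≡⟨ cong₂ _+_ (dist-∩ p q′) (dist-∩ p′ q) ⟩
  (∣ p ∣ + ∣ q′ ∣) + (∣ p′ ∣ + ∣ q ∣)
    ≡⟨ regroup′ (∣ p ∣) (∣ q′ ∣) (∣ p′ ∣) (∣ q ∣) ⟩
  (∣ p ∣ + ∣ q ∣) + (∣ p′ ∣ + ∣ q′ ∣)
    ≡⟨ cong₂ _+_ pq≡s p′q′≡s ⟩
  s + s
    ≡⟨ cong (_+_ s) (sym (ℕ.+-identityʳ s)) ⟩
  2 * s ∎
  where
  open ≡-Reasoning
  regroup : ∀ x y u v → (x + y) + 2 * (u + v) ≡ (x + 2 * u) + (y + 2 * v)
  regroup = ℕ-solve
  regroup′ : ∀ a b c d → (a + b) + (c + d) ≡ (a + d) + (c + b)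
  regroup′ = ℕ-solve

-≤⇐ : ∀ {a b c} → a ≤ c + b → + a - + b ℤ.≤ + c
-≤⇐ {a} {b} {c} a≤c+b = subst (+ a - + b ℤ.≤_) (cancel (+ c) (+ b)) (ℤ.+-monoˡ-≤ (ℤ.- + b) (ℤ.+≤+ a≤c+b))
  where
  cancel : ∀ c b → (c ℤ.+ b) - b ≡ c
  cancel = ℤ-solve

≤-⇐ : ∀ {a b c} → c + b ≤ a → + c ℤ.≤ + a - + b
≤-⇐ {a} {b} {c} c+b≤a = subst (ℤ._≤ + a - + b) (cancel (+ c) (+ b)) (ℤ.+-monoˡ-≤ (ℤ.- + b) (ℤ.+≤+ c+b≤a))
  where
  cancel : ∀ c b → (c ℤ.+ b) - b ≡ c
  cancel = ℤ-solve

-≡⇒ : ∀ {a b c} → + a - + b ≡ + c → a ≡ c + b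
-≡⇒ {a} {b} {c} a-b≡c = ℤ.+-injective (trans (sym (cancel (+ a) (+ b))) (cong (ℤ._+ + b) a-b≡c))
  where
  cancel : ∀ a b → (a - b) ℤ.+ b ≡ a
  cancel = ℤ-solve

setPairs⇒admissible : ∀ {N m} s p ℓ (A B : Fin m → Subset N) → 2 * ℓ ≤ p →
  (∀ i → ∣ A i ∣ + ∣ B i ∣ ≡ s) → (∀ i → ∣ A i ∩ B i ∣ ≤ ℓ) →
  (∀ {i j} → i ≢ j → p ≤ ∣ A i ∩ B j ∣ + ∣ A j ∩ B i ∣) →
  Admissible (+ s - + p) (p ∸ 2 * ℓ) m
setPairs⇒admissible {N} s p ℓ A B 2ℓ≤p sizes small large =
  N + suc s , ℤ.≤-<-trans (ℤ.i-j≤i (+ s) (+ p)) (ℤ.+<+ (ℕ.m≤n+m (suc s) N)) , a , b , far , close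
  where
  a b : Fin _ → Vec Bool (N + suc s)
  a i = A i ++ replicate (suc s) false
  b i = B i ++ replicate (suc s) false
  far : ∀ i → + s - + p ℤ.+ + (p ∸ 2 * ℓ) ℤ.≤ + dist (a i) (b i)
  far i = begin
    + s - + p ℤ.+ + (p ∸ 2 * ℓ)     ≡⟨ cong (ℤ._+_ (+ s - + p)) (pos-∸ 2ℓ≤p) ⟩
    + s - + p ℤ.+ (+ p - + (2 * ℓ)) ≡⟨ cancel (+ s) (+ p) (+ (2 * ℓ)) ⟩
    + s - + (2 * ℓ)                 ≤⟨ -≤⇐ (ℕ.≤-trans (ℕ.≤-reflexive (sym (trans (dist-∩ (A i) (B i)) (sizes i))))
                                          (ℕ.+-monoʳ-≤ (dist (A i) (B i)) (ℕ.*-monoʳ-≤ 2 (small i)))) ⟩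
    + dist (A i) (B i)              ≡⟨ cong +_ (sym (dist-++ (A i) (B i) _)) ⟩
    + dist (a i) (b i)              ∎
    where
    open ℤ.≤-Reasoning
    pos-∸ : ∀ {p q} → q ≤ p → + (p ∸ q) ≡ + p - + q
    pos-∸ {p} {q} q≤p = sym (trans (ℤ.[+m]-[+n]≡m⊖n p q) (ℤ.⊖-≥ q≤p))
    cancel : ∀ s p q → (s - p) ℤ.+ (p - q) ≡ s - q
    cancel = ℤ-solve
  close : ∀ i j → i ≢ j → + (dist (a i) (b j) + dist (a j) (b i)) ℤ.≤ + 2 ℤ.* (+ s - + p)
  close i j i≢j = begin
    + (dist (a i) (b j) + dist (a j) (b i))
      ≡⟨ cong +_ (cong₂ _+_ (dist-++ (A i) (B j) _) (dist-++ (A j) (B i) _)) ⟩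
    + c
      ≤⟨ ≤-⇐ (ℕ.≤-trans (ℕ.+-monoʳ-≤ c (ℕ.*-monoʳ-≤ 2 (large i≢j))) (ℕ.≤-reflexive c+2I≡2s)) ⟩
    + (2 * s) - + (2 * p)
      ≡⟨ cong₂ _-_ (ℤ.pos-* 2 s) (ℤ.pos-* 2 p) ⟩
    + 2 ℤ.* + s - + 2 ℤ.* + p
      ≡⟨ sym (distrib (+ s) (+ p)) ⟩
    + 2 ℤ.* (+ s - + p) ∎
    where
    open ℤ.≤-Reasoning
    c = dist (A i) (B j) + dist (A j) (B i)
    c+2I≡2s : c + 2 * (∣ A i ∩ B j ∣ + ∣ A j ∩ B i ∣) ≡ 2 * s
    c+2I≡2s = cross-dist-∩ (A i) (B i) (A j) (B j) (sizes i) (sizes j)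
    distrib : ∀ s p → + 2 ℤ.* (s - p) ≡ + 2 ℤ.* s - + 2 ℤ.* p
    distrib = ℤ-solve

ordered⇒distinct : ∀ {m} (R : Fin m → Fin m → Set) → (∀ {i j} → R i j → R j i) →
  (∀ i j → i <ᶠ j → R i j) → ∀ {i j} → i ≢ j → R i j
ordered⇒distinct R flip ordered {i} {j} i≢j with Fin.<-cmp i j
... | tri< i<j _ _ = ordered i j i<j
... | tri≈ _ i≡j _ = ⊥-elim (i≢j i≡j)
... | tri> _ _ j<i = flip (ordered j i j<i)

radius-shift : ∀ K ℓ → 2 * ((K + ℓ) + 1) ∸ 2 * ℓ ≡ 2 * suc K
radius-shift K ℓ = trans (cong (_∸ 2 * ℓ) (regroup K ℓ)) (ℕ.m+n∸n≡m (2 * suc K) (2 * ℓ))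
  where
  regroup : ∀ K ℓ → 2 * ((K + ℓ) + 1) ≡ 2 * suc K + 2 * ℓ
  regroup = ℕ-solve

dimension-shift : ∀ t K ℓ → t + 2 * ((K + ℓ) + 1) ∸ 2 * ℓ ∸ 1 ≡ t + suc (2 * K)
dimension-shift t K ℓ = cong (_∸ 1) (trans (cong (_∸ 2 * ℓ) (regroup t K ℓ)) (ℕ.m+n∸n≡m _ (2 * ℓ)))
  where
  regroup : ∀ t K ℓ → t + 2 * ((K + ℓ) + 1) ≡ suc (t + suc (2 * K)) + 2 * ℓ
  regroup = ℕ-solve

f′-upper-bound : ∀ s k ℓ m → ℓ ≤ k → Admissible (+ s - + (2 * (k + 1))) (2 * (k + 1) ∸ 2 * ℓ) m →
  m * binomSum (s ∸ 2 * ℓ ∸ 1) (k ∸ ℓ) ≤ 2 ^ (s ∸ 2 * ℓ ∸ 1)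
f′-upper-bound s k ℓ zero             ℓ≤k _   = z≤n
f′-upper-bound s k ℓ (suc zero)       ℓ≤k _   =
  ℕ.≤-trans (ℕ.≤-reflexive (ℕ.+-identityʳ _)) (binomSum≤2^ (s ∸ 2 * ℓ ∸ 1) (k ∸ ℓ))
f′-upper-bound s k ℓ m@(suc (suc _)) ℓ≤k adm with t , t-shift ← admissible-nonneg adm =
  subst (λ d → m * binomSum d K ≤ 2 ^ d) (sym dimension)
    (admissible-bound t K m (subst₂ (λ t r → Admissible t r m) t-shift radius adm))
  where
  K = k ∸ ℓ
  k≡K+ℓ : k ≡ K + ℓ
  k≡K+ℓ = sym (ℕ.m∸n+n≡m ℓ≤k)
  radius : 2 * (k + 1) ∸ 2 * ℓ ≡ 2 * suc K
  radius = trans (cong (λ k → 2 * (k + 1) ∸ 2 * ℓ) k≡K+ℓ) (radius-shift K ℓ)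
  dimension : s ∸ 2 * ℓ ∸ 1 ≡ t + suc (2 * K)
  dimension = begin
    s ∸ 2 * ℓ ∸ 1                       ≡⟨ cong (λ s → s ∸ 2 * ℓ ∸ 1) (-≡⇒ t-shift) ⟩
    t + 2 * (k + 1) ∸ 2 * ℓ ∸ 1         ≡⟨ cong (λ k → t + 2 * (k + 1) ∸ 2 * ℓ ∸ 1) k≡K+ℓ ⟩
    t + 2 * ((K + ℓ) + 1) ∸ 2 * ℓ ∸ 1   ≡⟨ dimension-shift t K ℓ ⟩
    t + suc (2 * K)                     ∎
    where open ≡-Reasoning

theorem3p4 : (s k ℓ m : ℕ) → k < s → ℓ ≤ k →
    (N : ℕ) (A B : Fin m → Subset N) →
    ((i : Fin m) → ∣ A i ∣ + ∣ B i ∣ ≡ s) →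
    ((i : Fin m) → ∣ A i ∩ B i ∣ ≤ ℓ) →
    ((i j : Fin m) → i <ᶠ j → 2 * (k + 1) ≤ ∣ A i ∩ B j ∣ + ∣ A j ∩ B i ∣) →
    (Σ ℕ λ m′ → (m ≤ m′) × Admissible (+ s - + (2 * (k + 1))) (2 * (k + 1) ∸ 2 * ℓ) m′)
    × (2 * ℓ < s → (m′ : ℕ) → Admissible (+ s - + (2 * (k + 1))) (2 * (k + 1) ∸ 2 * ℓ) m′ →
         m′ * binomSum (s ∸ 2 * ℓ ∸ 1) (k ∸ ℓ) ≤ 2 ^ (s ∸ 2 * ℓ ∸ 1))
theorem3p4 s k ℓ m _ ℓ≤k N A B sizes small ordered =
  (m , ℕ.≤-refl , setPairs⇒admissible s p ℓ A B 2ℓ≤p sizes small cross) ,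
  λ _ m′ → f′-upper-bound s k ℓ m′ ℓ≤k
  where
  p = 2 * (k + 1)
  2ℓ≤p : 2 * ℓ ≤ p
  2ℓ≤p = ℕ.*-monoʳ-≤ 2 (ℕ.m≤n⇒m≤n+o 1 ℓ≤k)
  cross : ∀ {i j} → i ≢ j → p ≤ ∣ A i ∩ B j ∣ + ∣ A j ∩ B i ∣
  cross = ordered⇒distinct _ (λ {i} {j} → subst (p ≤_) (ℕ.+-comm ∣ A i ∩ B j ∣ ∣ A j ∩ B i ∣)) ordered
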